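{- Let $\lambda$ be a triangular partition, $\theta$ a standard Young tableau of shape $\lambda$, $\mu\subseteq\lambda$ a subpartition, and $c$ a $\theta$-deficit cell of $(\lambda,\mu)$. Then $c$ lies in the interior of $\lambda$, i.e. $a(c)>0$ and $\ell(c)>0$, where the arm and leg are taken in $\lambda$.
   Context: Partitions are drawn in French convention: cell $(\ell,c)$ ($\ell\ge0$ row from bottom, $c\ge0$ column) belongs to $\lambda$ iff $c<\lambda_{\ell+1}$. A partition is triangular if there exist positive reals $r,s$ with $\lambda_j=\lfloor r-jr/s\rfloor$ for integers $1\le j\le s$ and $\lambda_j=0$ for $j>s$. The arm $a(c)$ (resp. leg $\ell(c)$) of a cell $c$ of $\lambda$ is the number of cells of $\lambda$ strictly to the right of $c$ in its row (resp. strictly above $c$ in its column). A standard Young tableau of shape $\lambda$ is a bijection from the cells to $\{1,\dots,|\lambda|\}$ increasing along rows and up columns. A cell $d$ is a $\theta$-deficit cell of $(\lambda,\mu)$ if there exist cells $c_1=(i_1,j_1)\in\mu$ and $c_2=(i_2,j_2)\in\lambda\setminus\mu$ with $\theta(c_1)>\theta(c_2)$ and $d=(\min(i_1,i_2),\min(j_1,j_2))$.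
   Formalization: The parameters r and s in the definition of a triangular partition are positive rationals rather than positive reals. -}

module Defs where

open import Data.Nat as ℕ using (ℕ; zero; suc; _+_; _∸_; _≤_; _<_; _<?_)
open import Data.Nat.ListAction using (sum)
open import Data.List using (List; []; _∷_; length; filter; upTo)
open import Data.List.Relation.Unary.All using (All)
open import Data.List.Relation.Unary.Linked using (Linked)
open import Data.Product using (Σ; ∃; _×_; _,_)
open import Data.Integer as ℤ using (ℤ; +_)
open import Data.Rational as ℚ using (ℚ; 0ℚ; floor; >-nonZero)
open import Relation.Binary.PropositionalEquality using (_≡_)
open import Relation.Nullary using (¬_)
open import Relation.Nullary.Decidable using (_×-dec_)

record Partition : Set where
  constructor mkPartition
  field
    parts      : List ℕ
    decreasing : Linked (λ a b → b ≤ a) parts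
    positive   : All (0 <_) parts
open Partition public

-- part λ j = λ_j (1-indexed), with λ_j = 0 beyond the length.
nth : List ℕ → ℕ → ℕ
nth []       _       = 0
nth (x ∷ xs) zero    = x
nth (x ∷ xs) (suc k) = nth xs k

part : Partition → ℕ → ℕ
part λp zero    = 0
part λp (suc k) = nth (parts λp) k

size : Partition → ℕ
size λp = sum (parts λp)

-- Cells: (ℓ , c) with ℓ the row from the bottom, c the column (French convention).
Cell : Set
Cell = ℕ × ℕ

_∈ᶜ_ : Cell → Partition → Set
(ℓ , c) ∈ᶜ λp = c < part λp (suc ℓ)

ℕtoℚ : ℕ → ℚ
ℕtoℚ n = (+ n) ℚ./ 1

triVal : (r s : ℚ) → 0ℚ ℚ.< s → ℕ → ℚ
triVal r s s>0 j = r ℚ.- ((ℕtoℚ j ℚ.* r) ℚ.÷ s) {{>-nonZero s>0}}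

Triangular : Partition → Set
Triangular λp =
  Σ ℚ λ r → Σ ℚ λ s → 0ℚ ℚ.< r × Σ (0ℚ ℚ.< s) λ s>0 →
    ((j : ℕ) → 1 ≤ j → ℕtoℚ j ℚ.≤ s → floor (triVal r s s>0 j) ≡ + part λp j)
    × ((j : ℕ) → s ℚ.< ℕtoℚ j → part λp j ≡ 0)

record IsSYT (λp : Partition) (θ : Cell → ℕ) : Set where
  field
    range      : ∀ x → x ∈ᶜ λp → 1 ≤ θ x × θ x ≤ size λp
    injective  : ∀ x y → x ∈ᶜ λp → y ∈ᶜ λp → θ x ≡ θ y → x ≡ y
    surjective : ∀ n → 1 ≤ n → n ≤ size λp → ∃ λ x → x ∈ᶜ λp × θ x ≡ n
    rowIncr    : ∀ ℓ c → (ℓ , suc c) ∈ᶜ λp → θ (ℓ , c) < θ (ℓ , suc c)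
    colIncr    : ∀ ℓ c → (suc ℓ , c) ∈ᶜ λp → θ (ℓ , c) < θ (suc ℓ , c)

_⊆ᵖ_ : Partition → Partition → Set
μ ⊆ᵖ λp = ∀ j → part μ j ≤ part λp j

IsDeficit : (θ : Cell → ℕ) (λp μ : Partition) → Cell → Set
IsDeficit θ λp μ d =
  Σ ℕ λ i₁ → Σ ℕ λ j₁ → Σ ℕ λ i₂ → Σ ℕ λ j₂ →
    (i₁ , j₁) ∈ᶜ μ × (i₂ , j₂) ∈ᶜ λp × ¬ ((i₂ , j₂) ∈ᶜ μ)
    × θ (i₂ , j₂) < θ (i₁ , j₁)
    × d ≡ (ℕ._⊓_ i₁ i₂ , ℕ._⊓_ j₁ j₂)

arm : Partition → Cell → ℕ
arm λp (ℓ , c) = part λp (suc ℓ) ∸ suc c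

leg : Partition → Cell → ℕ
leg λp (ℓ , c) =
  length (filter (λ k → (ℓ <? k) ×-dec (c <? part λp (suc k))) (upTo (length (parts λp))))

{-# OPTIONS --safe #-}
-- A standard Young tableau increases weakly towards the north-east, so a cell c₁ of μ
-- with a larger entry than a cell c₂ of λ ∖ μ can lie neither weakly south-west of c₂
-- (by monotonicity of θ) nor weakly north-east of it (μ is a partition). Hence one of
-- the two cells lies strictly left of and above the other, and their corner
-- (min rows, min columns) has a cell of λ to its right and one above it.
module Submission where

open import Defs
open import Data.Nat using (ℕ; suc; z≤n; s≤s; _≤_; _<_; _≤′_; ≤′-refl; ≤′-step; _≤?_; _<?_; _⊓_)
open import Data.Nat.Properties
open import Data.Product using (_×_; _,_)
open import Data.Sum using (_⊎_; inj₁; inj₂)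
open import Data.List using (_∷_; length)
open import Data.List.Relation.Unary.Linked using (Linked; []; [-]; _∷_)
open import Data.List.Membership.Propositional.Properties using (∈-upTo⁺; ∈-filter⁺; ∈-length)
open import Relation.Nullary using (¬_; yes; no)
open import Relation.Nullary.Decidable using (_×-dec_)
open import Relation.Binary.PropositionalEquality using (refl; cong₂; subst)
open import Data.Empty using (⊥-elim)

private
  variable
    θ : Cell → ℕ
    i i′ j j′ : ℕ

nth-suc≤nth : ∀ {xs} → Linked (λ a b → b ≤ a) xs → ∀ k → nth xs (suc k) ≤ nth xs k
nth-suc≤nth []      _       = z≤n
nth-suc≤nth [-]     _       = z≤n
nth-suc≤nth (r ∷ _) 0       = r
nth-suc≤nth (_ ∷ l) (suc k) = nth-suc≤nth l k

<nth⇒<length : ∀ xs k {c} → c < nth xs k → k < length xs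
<nth⇒<length (_ ∷ _)  0       _ = s≤s z≤n
<nth⇒<length (_ ∷ xs) (suc k) h = s≤s (<nth⇒<length xs k h)

part-antitone : (λp : Partition) → i ≤′ i′ → part λp (suc i′) ≤ part λp (suc i)
part-antitone _  ≤′-refl            = ≤-refl
part-antitone λp (≤′-step {n} i≤′n) =
  ≤-trans (nth-suc≤nth (decreasing λp) n) (part-antitone λp i≤′n)

∈ᶜ-downClosed : (λp : Partition) → i ≤ i′ → j ≤ j′ → (i′ , j′) ∈ᶜ λp → (i , j) ∈ᶜ λp
∈ᶜ-downClosed λp i≤i′ j≤j′ c∈λ =
  ≤-<-trans j≤j′ (<-≤-trans c∈λ (part-antitone λp (≤⇒≤′ i≤i′)))

⊆ᵖ-∈ᶜ : (μ λp : Partition) → μ ⊆ᵖ λp → (i , j) ∈ᶜ μ → (i , j) ∈ᶜ λp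
⊆ᵖ-∈ᶜ {i = i} _ _ μ⊆λ c∈μ = <-≤-trans c∈μ (μ⊆λ (suc i))

module _ {λp : Partition} (syt : IsSYT λp θ) where
  open IsSYT syt

  syt-monoʳ : j ≤′ j′ → (i , j′) ∈ᶜ λp → θ (i , j) ≤ θ (i , j′)
  syt-monoʳ         ≤′-refl            _   = ≤-refl
  syt-monoʳ {i = i} (≤′-step {n} j≤′n) c∈λ =
    ≤-trans (syt-monoʳ j≤′n (∈ᶜ-downClosed λp ≤-refl (n≤1+n n) c∈λ))
            (<⇒≤ (rowIncr i n c∈λ))

  syt-monoˡ : i ≤′ i′ → (i′ , j) ∈ᶜ λp → θ (i , j) ≤ θ (i′ , j)
  syt-monoˡ         ≤′-refl            _   = ≤-refl
  syt-monoˡ {j = j} (≤′-step {n} i≤′n) c∈λ =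
    ≤-trans (syt-monoˡ i≤′n (∈ᶜ-downClosed λp (n≤1+n n) ≤-refl c∈λ))
            (<⇒≤ (colIncr n j c∈λ))

  syt-mono : i ≤ i′ → j ≤ j′ → (i′ , j′) ∈ᶜ λp → θ (i , j) ≤ θ (i′ , j′)
  syt-mono i≤i′ j≤j′ c∈λ =
    ≤-trans (syt-monoʳ (≤⇒≤′ j≤j′) (∈ᶜ-downClosed λp i≤i′ ≤-refl c∈λ))
            (syt-monoˡ (≤⇒≤′ i≤i′) c∈λ)

incomparable : ¬ (i ≤ i′ × j ≤ j′) → ¬ (i′ ≤ i × j′ ≤ j)
             → (i < i′ × j′ < j) ⊎ (i′ < i × j < j′)
incomparable {i} {i′} {j} {j′} ¬≤ ¬≥ with i ≤? i′ | j ≤? j′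
... | yes i≤i′ | yes j≤j′ = ⊥-elim (¬≤ (i≤i′ , j≤j′))
... | yes i≤i′ | no  j≰j′ =
  inj₁ (≤∧≢⇒< i≤i′ (λ { refl → ¬≥ (≤-refl , <⇒≤ (≰⇒> j≰j′)) }) , ≰⇒> j≰j′)
... | no  i≰i′ | yes j≤j′ =
  inj₂ (≰⇒> i≰i′ , ≤∧≢⇒< j≤j′ (λ { refl → ¬≥ (<⇒≤ (≰⇒> i≰i′) , ≤-refl) }))
... | no  i≰i′ | no  j≰j′ = ⊥-elim (¬≥ (<⇒≤ (≰⇒> i≰i′) , <⇒≤ (≰⇒> j≰j′)))

deficit-incomparable : (λp μ : Partition) → IsSYT λp θ
  → (i , j) ∈ᶜ μ → (i′ , j′) ∈ᶜ λp → ¬ ((i′ , j′) ∈ᶜ μ) → θ (i′ , j′) < θ (i , j)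
  → (i < i′ × j′ < j) ⊎ (i′ < i × j < j′)
deficit-incomparable λp μ syt c₁∈μ c₂∈λ c₂∉μ θ₂<θ₁ =
  incomparable (λ (i≤ , j≤) → <⇒≱ θ₂<θ₁ (syt-mono syt i≤ j≤ c₂∈λ))
               (λ (i≥ , j≥) → c₂∉μ (∈ᶜ-downClosed μ i≥ j≥ c₁∈μ))

Interior : Partition → Cell → Set
Interior λp d = d ∈ᶜ λp × 0 < arm λp d × 0 < leg λp d

arm-pos : (λp : Partition) → (i , suc j) ∈ᶜ λp → 0 < arm λp (i , j)
arm-pos _ = m<n⇒0<n∸m

leg-pos : (λp : Partition) → i < i′ → (i′ , j) ∈ᶜ λp → 0 < leg λp (i , j)
leg-pos {i} {i′} {j} λp i<i′ c∈λ =
  ∈-length (∈-filter⁺ (λ k → (i <? k) ×-dec (j <? part λp (suc k)))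
             (∈-upTo⁺ (<nth⇒<length (parts λp) i′ c∈λ)) (i<i′ , c∈λ))

corner-interior : (λp : Partition) → (i , j) ∈ᶜ λp → (i′ , j′) ∈ᶜ λp → i < i′ → j′ < j
                → Interior λp (i ⊓ i′ , j ⊓ j′)
corner-interior λp c∈λ c′∈λ i<i′ j′<j
  rewrite m≤n⇒m⊓n≡m (<⇒≤ i<i′) | m≥n⇒m⊓n≡n (<⇒≤ j′<j) =
    ∈ᶜ-downClosed λp ≤-refl (<⇒≤ j′<j) c∈λ ,
    arm-pos λp (∈ᶜ-downClosed λp ≤-refl j′<j c∈λ) ,
    leg-pos λp i<i′ c′∈λ

lemma3p5 : (λp : Partition) → Triangular λp → (θ : Cell → ℕ) → IsSYT λp θ
    → (μ : Partition) → μ ⊆ᵖ λp → (d : Cell) → IsDeficit θ λp μ d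
    → d ∈ᶜ λp × 0 < arm λp d × 0 < leg λp d
lemma3p5 λp _ θ syt μ μ⊆λ _ (i₁ , j₁ , i₂ , j₂ , c₁∈μ , c₂∈λ , c₂∉μ , θ₂<θ₁ , refl)
  with deficit-incomparable λp μ syt c₁∈μ c₂∈λ c₂∉μ θ₂<θ₁
... | inj₁ (i₁<i₂ , j₂<j₁) = corner-interior λp (⊆ᵖ-∈ᶜ μ λp μ⊆λ c₁∈μ) c₂∈λ i₁<i₂ j₂<j₁
... | inj₂ (i₂<i₁ , j₁<j₂) =
  subst (Interior λp) (cong₂ _,_ (⊓-comm i₂ i₁) (⊓-comm j₂ j₁))
        (corner-interior λp c₂∈λ (⊆ᵖ-∈ᶜ μ λp μ⊆λ c₁∈μ) i₂<i₁ j₁<j₂)
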